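{- (i) $K_2$ is the unique connected graph $G$ in $\mathbf{W}_2$ with $|V(G)|=2\alpha(G)$. (ii) $C_3$ and $C_5$ are the only connected graphs $G$ in $\mathbf{W}_2$ with $|V(G)|=2\alpha(G)+1$. (iii) $K_2$ is the only connected bipartite graph belonging to $\mathbf{W}_2$.
   Context: Graphs are finite, simple, undirected, with non-empty vertex set. An independent set is a set of pairwise non-adjacent vertices; $\alpha(G)$ is the maximum size of an independent set. A graph belongs to $\mathbf{W}_2$ if every two disjoint independent sets are included, respectively, in two disjoint maximum independent sets. $C_n$ denotes the cycle on $n$ vertices and $K_2$ the complete graph on two vertices. -}

module Defs where

open import Data.Nat using (ℕ; zero; suc; _≤_; _%_; NonZero)
open import Data.Fin using (Fin; toℕ)
open import Data.Fin.Properties using () renaming (_≟_ to _≟ᶠ_)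
open import Data.Fin.Subset using (Subset; _∈_; _⊆_; ∣_∣)
open import Data.Bool using (Bool; true; false; not; _∨_)
open import Data.Product using (Σ; _×_; ∃; ∃-syntax)
open import Data.Empty using (⊥)
open import Relation.Nullary.Decidable using (⌊_⌋)
open import Relation.Binary.PropositionalEquality using (_≡_)
import Data.Nat as ℕ

record Graph : Set where
  constructor mkGraph
  field
    n   : ℕ
    adj : Fin n → Fin n → Bool
open Graph public

record IsSimpleGraph (G : Graph) : Set where
  field
    nonempty : 1 ≤ n G
    symmetric : ∀ u v → adj G u v ≡ adj G v u
    irreflexive : ∀ u → adj G u u ≡ false

module _ (G : Graph) where
  Independent : Subset (n G) → Set
  Independent S = ∀ u v → u ∈ S → v ∈ S → adj G u v ≡ false

  MaximumIndependent : Subset (n G) → Set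
  MaximumIndependent S =
    Independent S × (∀ T → Independent T → ∣ T ∣ ≤ ∣ S ∣)

  IsAlpha : ℕ → Set
  IsAlpha a = (∃[ S ] (Independent S × ∣ S ∣ ≡ a))
            × (∀ T → Independent T → ∣ T ∣ ≤ a)

  data Reach : Fin (n G) → Fin (n G) → Set where
    here : ∀ {u} → Reach u u
    step : ∀ {u w v} → adj G u w ≡ true → Reach w v → Reach u v

  Connected : Set
  Connected = ∀ u v → Reach u v

  Bipartite : Set
  Bipartite = Σ (Fin (n G) → Bool) λ c → ∀ u v → adj G u v ≡ true → c u ≡ not (c v)

Disjoint : ∀ {m} → Subset m → Subset m → Set
Disjoint S T = ∀ x → x ∈ S → x ∈ T → ⊥

W₂ : Graph → Set
W₂ G = ∀ S T → Independent G S → Independent G T → Disjoint S T →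
       ∃[ S' ] ∃[ T' ] (MaximumIndependent G S' × MaximumIndependent G T'
                        × S ⊆ S' × T ⊆ T' × Disjoint S' T')

record _≅_ (G H : Graph) : Set where
  field
    to    : Fin (n G) → Fin (n H)
    from  : Fin (n H) → Fin (n G)
    from∘to : ∀ x → from (to x) ≡ x
    to∘from : ∀ y → to (from y) ≡ y
    preserves : ∀ u v → adj H (to u) (to v) ≡ adj G u v

K₂ : Graph
K₂ = mkGraph 2 (λ u v → not ⌊ u ≟ᶠ v ⌋)

C : (m : ℕ) → .{{NonZero m}} → Graph
C m = mkGraph m (λ u v → ⌊ toℕ v ℕ.≟ suc (toℕ u) % m ⌋ ∨ ⌊ toℕ u ℕ.≟ suc (toℕ v) % m ⌋)

module Submission where

-- The argument rests on one counting principle: W₂ extends disjoint independent sets S, T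
-- to disjoint maximum independent sets S′, T′, so n ≥ 2α + |D| for any set D of vertices avoiding
-- S′ ∪ T′, e.g. vertices with a neighbour in S and one in T. For n = 2α this forbids vertices of degree
-- two; since a connected W₂ graph with a leaf is K₂, only K₂ is left. For n = 2α + 1 it forbids degree
-- three and leaves, so G is a cycle; a C₄ or an induced path on six vertices would give two such
-- vertices, leaving C₃ and C₅. A bipartite graph is covered by two independent sets, so n ≤ 2α.

open import Defs
open import Data.Bool using (Bool; true; false; not; if_then_else_)
open import Data.Bool.Properties using (¬-not; not-¬; ∨-comm) renaming (_≟_ to _≟ᵇ_)
open import Data.Empty using (⊥; ⊥-elim)
open import Data.Fin using (Fin; zero; suc; toℕ; fromℕ<; punchIn)
open import Data.Fin.Patterns using (0F; 1F; 2F; 3F; 4F)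
open import Data.Fin.Permutation using (permutation; ↔⇒≡)
open import Data.Fin.Properties using (toℕ-injective; toℕ-fromℕ<; punchInᵢ≢i; any?; all?)
  renaming (_≟_ to _≟ᶠ_)
open import Data.Fin.Subset
  using (Subset; _∈_; _∉_; _⊆_; ∣_∣; ⁅_⁆; _∪_; _-_; ∁; inside; outside)
  renaming (⊥ to ∅)
open import Data.Fin.Subset.Properties
  using ( ∣p∣≤n; ∣⊥∣≡0; ∣∁p∣≡n∸∣p∣; ∣⁅x⁆∣≡1; p⊆q⇒∣p∣≤∣q∣; ∉⊥; x∈⁅x⁆; x∈⁅y⁆⇒x≡y; x≢y⇒x∉⁅y⁆
        ; x∈∁p⇒x∉p; x∈p∪q⁺; x∈p∪q⁻; x∈p∧x≢y⇒x∈p-y; p─q⊆p; _∈?_; _⊆?_; anySubset?)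
open import Data.List using (List; []; _∷_; map; _++_; filter; cartesianProduct)
open import Data.List.Relation.Unary.Any using (Any; satisfied) renaming (any? to anyList?)
open import Data.Nat using (ℕ; zero; suc; _+_; _*_; _∸_; _≤_; s≤s; NonZero; _%_)
import Data.Nat as ℕ
open import Data.Nat.DivMod using (m%n<n)
open import Data.Nat.Properties
  using ( +-suc; +-comm; +-identityʳ; ≤-trans; ≤-reflexive; ≤-antisym; +-mono-≤; m+1+n≰m; m+[n∸m]≡n
        ; 1+n≰n; even≢odd; +-0-commutativeMonoid; module ≤-Reasoning)
open import Algebra.Properties.CommutativeMonoid.Sum +-0-commutativeMonoid using (sum; sum-permute; sum-cong-≗)
open import Data.Product using (_×_; _,_; proj₁; proj₂; ∃-syntax)
open import Data.Sum using (_⊎_; inj₁; inj₂)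
open import Data.Vec using (Vec; []; _∷_; lookup; tabulate)
open import Data.Vec.Base using (here; there)
open import Data.Vec.Properties using ([]=⇒lookup; lookup⇒[]=; lookup∘tabulate)
open import Data.Vec.Relation.Unary.All using ([]; _∷_)
open import Data.Vec.Relation.Unary.AllPairs using ([]; _∷_)
open import Data.Vec.Relation.Unary.Unique.Propositional using (Unique)
open import Data.Vec.Relation.Unary.Unique.Propositional.Properties using (lookup-injective)
open import Function using (_∘_)
open import Function.Bundles using (_⇔_; mk⇔)
open import Relation.Binary.PropositionalEquality
  using (_≡_; _≢_; refl; sym; trans; cong; cong₂; subst; subst₂; ≢-sym; module ≡-Reasoning)
open import Relation.Nullary using (¬_; Dec; yes; no; ¬?)
open import Relation.Nullary.Decidable using (⌊_⌋; _→-dec_; _×-dec_; decidable-stable; True; toWitness)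

private
  variable
    m : ℕ
    x y z : Fin m
    p q r : Subset m

n+2≰n+1 : ∀ k → ¬ (k + 2 ≤ k + 1)
n+2≰n+1 k = 1+n≰n ∘ subst (_≤ k + 1) (+-suc k 1)

2*m≡m+m : ∀ m → 2 * m ≡ m + m
2*m≡m+m m = cong (m +_) (+-identityʳ m)

true≢false : true ≢ false
true≢false ()

≢true⇒≡false : ∀ {b} → b ≢ true → b ≡ false
≢true⇒≡false = ¬-not

x∈⁅x⁆∪⁅y⁆ : x ∈ ⁅ x ⁆ ∪ ⁅ y ⁆
x∈⁅x⁆∪⁅y⁆ {x = x} = x∈p∪q⁺ (inj₁ (x∈⁅x⁆ x))

y∈⁅x⁆∪⁅y⁆ : y ∈ ⁅ x ⁆ ∪ ⁅ y ⁆
y∈⁅x⁆∪⁅y⁆ {y = y} = x∈p∪q⁺ (inj₂ (x∈⁅x⁆ y))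

∈⁅x⁆∪⁅y⁆⇒ : z ∈ ⁅ x ⁆ ∪ ⁅ y ⁆ → z ≡ x ⊎ z ≡ y
∈⁅x⁆∪⁅y⁆⇒ {x = x} {y = y} z∈ with x∈p∪q⁻ ⁅ x ⁆ ⁅ y ⁆ z∈
... | inj₁ z∈⁅x⁆ = inj₁ (x∈⁅y⁆⇒x≡y x z∈⁅x⁆)
... | inj₂ z∈⁅y⁆ = inj₂ (x∈⁅y⁆⇒x≡y y z∈⁅y⁆)

⁅x⁆∪⁅y⁆⊆ : x ∈ p → y ∈ p → ⁅ x ⁆ ∪ ⁅ y ⁆ ⊆ p
⁅x⁆∪⁅y⁆⊆ x∈p y∈p z∈ with ∈⁅x⁆∪⁅y⁆⇒ z∈
... | inj₁ refl = x∈p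
... | inj₂ refl = y∈p

∉⇒Disjoint⁅⁆ : x ∉ p → Disjoint p ⁅ x ⁆
∉⇒Disjoint⁅⁆ {x = x} x∉p z z∈p z∈⁅x⁆ = x∉p (subst (_∈ _) (x∈⁅y⁆⇒x≡y x z∈⁅x⁆) z∈p)

∉⇒Disjoint⁅⁆∪⁅⁆ : x ∉ p → y ∉ p → Disjoint p (⁅ x ⁆ ∪ ⁅ y ⁆)
∉⇒Disjoint⁅⁆∪⁅⁆ x∉p y∉p z z∈p z∈ with ∈⁅x⁆∪⁅y⁆⇒ z∈
... | inj₁ refl = x∉p z∈p
... | inj₂ refl = y∉p z∈p

≢⇒Disjoint⁅⁆ : x ≢ y → Disjoint ⁅ x ⁆ ⁅ y ⁆
≢⇒Disjoint⁅⁆ x≢y = ∉⇒Disjoint⁅⁆ (x≢y⇒x∉⁅y⁆ (≢-sym x≢y))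

Disjoint-∪ˡ : Disjoint p r → Disjoint q r → Disjoint (p ∪ q) r
Disjoint-∪ˡ {p = p} {q = q} p∩r=∅ q∩r=∅ z z∈p∪q z∈r with x∈p∪q⁻ p q z∈p∪q
... | inj₁ z∈p = p∩r=∅ z z∈p z∈r
... | inj₂ z∈q = q∩r=∅ z z∈q z∈r

∪-⊆ : p ⊆ r → q ⊆ r → p ∪ q ⊆ r
∪-⊆ {p = p} {q = q} p⊆r q⊆r x∈p∪q with x∈p∪q⁻ p q x∈p∪q
... | inj₁ x∈p = p⊆r x∈p
... | inj₂ x∈q = q⊆r x∈q

x∉p-x : (p : Subset m) → x ∉ p - x
x∉p-x {x = zero}  (_ ∷ p) ()
x∉p-x {x = suc x} (_ ∷ p) (there x∈p-x) = x∉p-x p x∈p-x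

≢⇒Disjoint⁅⁆∪⁅⁆ : ∀ {w : Fin m} → x ≢ z → x ≢ w → y ≢ z → y ≢ w → Disjoint (⁅ x ⁆ ∪ ⁅ y ⁆) (⁅ z ⁆ ∪ ⁅ w ⁆)
≢⇒Disjoint⁅⁆∪⁅⁆ x≢z x≢w y≢z y≢w = Disjoint-∪ˡ
  (∉⇒Disjoint⁅⁆∪⁅⁆ (x≢y⇒x∉⁅y⁆ (≢-sym x≢z)) (x≢y⇒x∉⁅y⁆ (≢-sym x≢w)))
  (∉⇒Disjoint⁅⁆∪⁅⁆ (x≢y⇒x∉⁅y⁆ (≢-sym y≢z)) (x≢y⇒x∉⁅y⁆ (≢-sym y≢w)))

Disjoint-∅ˡ : Disjoint ∅ p
Disjoint-∅ˡ _ x∈∅ _ = ∉⊥ x∈∅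

Disjoint-∅ʳ : Disjoint p ∅
Disjoint-∅ʳ _ _ x∈∅ = ∉⊥ x∈∅

Disjoint-∷⁻ : ∀ {s t} → Disjoint (s ∷ p) (t ∷ q) → Disjoint p q
Disjoint-∷⁻ d z z∈p z∈q = d (suc z) (there z∈p) (there z∈q)

∣p∪q∣≡∣p∣+∣q∣ : (p q : Subset m) → Disjoint p q → ∣ p ∪ q ∣ ≡ ∣ p ∣ + ∣ q ∣
∣p∪q∣≡∣p∣+∣q∣ []          []          _ = refl
∣p∪q∣≡∣p∣+∣q∣ (inside ∷ p)  (inside ∷ q)  d = ⊥-elim (d zero here here)
∣p∪q∣≡∣p∣+∣q∣ (inside ∷ p)  (outside ∷ q) d = cong suc (∣p∪q∣≡∣p∣+∣q∣ p q (Disjoint-∷⁻ d))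
∣p∪q∣≡∣p∣+∣q∣ (outside ∷ p) (inside ∷ q)  d =
  trans (cong suc (∣p∪q∣≡∣p∣+∣q∣ p q (Disjoint-∷⁻ d))) (sym (+-suc ∣ p ∣ ∣ q ∣))
∣p∪q∣≡∣p∣+∣q∣ (outside ∷ p) (outside ∷ q) d = ∣p∪q∣≡∣p∣+∣q∣ p q (Disjoint-∷⁻ d)

∣⁅x⁆∪⁅y⁆∣≡2 : x ≢ y → ∣ ⁅ x ⁆ ∪ ⁅ y ⁆ ∣ ≡ 2
∣⁅x⁆∪⁅y⁆∣≡2 {x = x} {y = y} x≢y =
  trans (∣p∪q∣≡∣p∣+∣q∣ ⁅ x ⁆ ⁅ y ⁆ (≢⇒Disjoint⁅⁆ x≢y)) (cong₂ _+_ (∣⁅x⁆∣≡1 x) (∣⁅x⁆∣≡1 y))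

Disjoint⇒∣p∣+∣q∣≤m : (p q : Subset m) → Disjoint p q → ∣ p ∣ + ∣ q ∣ ≤ m
Disjoint⇒∣p∣+∣q∣≤m p q d = subst (_≤ _) (∣p∪q∣≡∣p∣+∣q∣ p q d) (∣p∣≤n (p ∪ q))

∈tabulate⁻ : ∀ {f : Fin m → Bool} {x} → x ∈ tabulate f → f x ≡ true
∈tabulate⁻ {f = f} {x} x∈ = trans (sym (lookup∘tabulate f x)) ([]=⇒lookup x∈)

∉tabulate⁻ : ∀ {f : Fin m → Bool} {x} → x ∉ tabulate f → f x ≡ false
∉tabulate⁻ {f = f} {x} x∉ = ≢true⇒≡false λ fx≡true → x∉ (lookup⇒[]= x _ (trans (lookup∘tabulate f x) fx≡true))

Independent-∅ : ∀ {G} → Independent G ∅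
Independent-∅ u v u∈∅ _ = ⊥-elim (∉⊥ u∈∅)

Biadjacent : (G : Graph) → Subset (n G) → Subset (n G) → Fin (n G) → Set
Biadjacent G S T d = (∃[ s ] (s ∈ S × adj G d s ≡ true)) × (∃[ t ] (t ∈ T × adj G d t ≡ true))

Reach-trans : ∀ {G u v w} → Reach G u v → Reach G v w → Reach G u w
Reach-trans here        r′ = r′
Reach-trans (step e r) r′ = step e (Reach-trans r r′)

Reach-sym : ∀ {G u v} → (∀ x y → adj G x y ≡ adj G y x) → Reach G u v → Reach G v u
Reach-sym sym-adj here       = here
Reach-sym sym-adj (step e r) = Reach-trans (Reach-sym sym-adj r) (step (trans (sym-adj _ _) e) here)

reachable-from⇒Connected : ∀ {G} → (∀ x y → adj G x y ≡ adj G y x) →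
                           (r : Fin (n G)) → (∀ v → Reach G r v) → Connected G
reachable-from⇒Connected sym-adj r reach u v = Reach-trans (Reach-sym sym-adj (reach u)) (reach v)

∃≢ : 2 ≤ m → (v : Fin m) → ∃[ u ] u ≢ v
∃≢ {suc (suc _)} _ v = punchIn v zero , punchInᵢ≢i v zero
∃≢ {suc zero} (s≤s ()) _

module SimpleGraph {G : Graph} (sg : IsSimpleGraph G) where
  open IsSimpleGraph sg

  private
    variable
      u v : Fin (n G)
      S T : Subset (n G)

  adj-sym : adj G u v ≡ true → adj G v u ≡ true
  adj-sym {u} {v} e = trans (symmetric v u) e

  adj⇒≢ : adj G u v ≡ true → u ≢ v
  adj⇒≢ {u} e refl with () ← trans (sym e) (irreflexive u)

  Independent-⊆ : S ⊆ T → Independent G T → Independent G S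
  Independent-⊆ S⊆T indT u v u∈S v∈S = indT u v (S⊆T u∈S) (S⊆T v∈S)

  Independent-⁅⁆ : ∀ x → Independent G ⁅ x ⁆
  Independent-⁅⁆ x u v u∈ v∈ rewrite x∈⁅y⁆⇒x≡y x u∈ | x∈⁅y⁆⇒x≡y x v∈ = irreflexive x

  Independent-∪⁅⁆ : Independent G S → (∀ s → s ∈ S → adj G x s ≡ false) → Independent G (S ∪ ⁅ x ⁆)
  Independent-∪⁅⁆ {S} {x} indS x≁S u v u∈ v∈ with x∈p∪q⁻ S ⁅ x ⁆ u∈ | x∈p∪q⁻ S ⁅ x ⁆ v∈
  ... | inj₁ u∈S | inj₁ v∈S = indS u v u∈S v∈S
  ... | inj₁ u∈S | inj₂ v∈⁅x⁆ rewrite x∈⁅y⁆⇒x≡y x v∈⁅x⁆ = trans (symmetric u x) (x≁S u u∈S)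
  ... | inj₂ u∈⁅x⁆ | inj₁ v∈S rewrite x∈⁅y⁆⇒x≡y x u∈⁅x⁆ = x≁S v v∈S
  ... | inj₂ u∈⁅x⁆ | inj₂ v∈⁅x⁆ = Independent-⁅⁆ x u v u∈⁅x⁆ v∈⁅x⁆

  Independent-⁅⁆∪⁅⁆ : adj G x y ≡ false → Independent G (⁅ x ⁆ ∪ ⁅ y ⁆)
  Independent-⁅⁆∪⁅⁆ {x} {y} x≁y = Independent-∪⁅⁆ (Independent-⁅⁆ x) y≁x
    where
    y≁x : ∀ s → s ∈ ⁅ x ⁆ → adj G y s ≡ false
    y≁x s s∈ rewrite x∈⁅y⁆⇒x≡y x s∈ = trans (symmetric y x) x≁y

  Independent⇒neighbour∉ : Independent G S → u ∈ S → adj G u v ≡ true → v ∉ S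
  Independent⇒neighbour∉ indS u∈S e v∈S with () ← trans (sym e) (indS _ _ u∈S v∈S)

  module _ (connected : Connected G) where

    connected-induction : (P : Fin (n G) → Set) → P u → (∀ {x y} → P x → adj G x y ≡ true → P y) → ∀ y → P y
    connected-induction {u} P Pu closed y = go (connected u y) Pu
      where
      go : ∀ {x y} → Reach G x y → P x → P y
      go here       Px = Px
      go (step e r) Px = go r (closed Px e)

    has-neighbour : 2 ≤ n G → ∀ v → ∃[ u ] adj G v u ≡ true
    has-neighbour 2≤n v with ∃≢ 2≤n v
    ... | u , u≢v = first-step (connected v u) u≢v
      where
      first-step : ∀ {v u} → Reach G v u → u ≢ v → ∃[ w ] adj G v w ≡ true
      first-step here        u≢u = ⊥-elim (u≢u refl)
      first-step (step e _)  _   = _ , e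

    -- The image is closed under taking neighbours, hence everything by connectivity.
    injective-local-iso⇒≅ : {H : Graph} (vs : Vec (Fin (n G)) (n H)) → Unique vs → Fin (n H) →
      (∀ i j → adj H i j ≡ true → adj G (lookup vs i) (lookup vs j) ≡ true) →
      (∀ i c → adj G (lookup vs i) c ≡ true → ∃[ j ] (adj H i j ≡ true × lookup vs j ≡ c)) →
      G ≅ H
    injective-local-iso⇒≅ {H} vs unique i₀ edges onto = record
      { to        = λ x → proj₁ (image x)
      ; from      = from
      ; from∘to   = λ x → proj₂ (image x)
      ; to∘from   = λ i → injective _ _ (proj₂ (image (from i)))
      ; preserves = λ u v → trans (sym (adj-from (proj₁ (image u)) (proj₁ (image v))))
                                  (cong₂ (adj G) (proj₂ (image u)) (proj₂ (image v)))
      }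
      where
      from = lookup vs
      injective = lookup-injective unique
      image : ∀ x → ∃[ i ] from i ≡ x
      image = connected-induction (λ x → ∃[ i ] from i ≡ x) (i₀ , refl)
        λ { (i , refl) e → let (j , _ , fj≡) = onto i _ e in j , fj≡ }
      adj-from : ∀ i j → adj G (from i) (from j) ≡ adj H i j
      adj-from i j with adj H i j in eq
      ... | true  = edges i j eq
      ... | false = ≢true⇒≡false λ e → let (j′ , e′ , fj′≡fj) = onto i _ e in
        true≢false (trans (sym e′) (trans (cong (adj H i) (injective _ _ fj′≡fj)) eq))

cycleSucc : ∀ {m} .{{_ : NonZero m}} → Fin m → Fin m
cycleSucc {m} i = fromℕ< (m%n<n (suc (toℕ i)) m)

C-symmetric : ∀ {m} .{{_ : NonZero m}} (i j : Fin m) → adj (C m) i j ≡ adj (C m) j i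
C-symmetric {m} i j = ∨-comm ⌊ toℕ j ℕ.≟ suc (toℕ i) % m ⌋ ⌊ toℕ i ℕ.≟ suc (toℕ j) % m ⌋

adj-C-cycleSucc : ∀ {m} .{{_ : NonZero m}} (i : Fin m) → adj (C m) i (cycleSucc i) ≡ true
adj-C-cycleSucc {m} i with toℕ (cycleSucc i) ℕ.≟ suc (toℕ i) % m
... | yes _  = refl
... | no  ne = ⊥-elim (ne (toℕ-fromℕ< _))

adj-C⇒ : ∀ {m} .{{_ : NonZero m}} (i j : Fin m) → adj (C m) i j ≡ true → j ≡ cycleSucc i ⊎ i ≡ cycleSucc j
adj-C⇒ {m} i j e with toℕ j ℕ.≟ suc (toℕ i) % m | toℕ i ℕ.≟ suc (toℕ j) % m
... | yes j≡ | _     = inj₁ (toℕ-injective (trans j≡ (sym (toℕ-fromℕ< _))))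
... | no _  | yes i≡ = inj₂ (toℕ-injective (trans i≡ (sym (toℕ-fromℕ< _))))
... | no _  | no _  with () ← e

-- Invariance under isomorphism

≅-sym : ∀ {G H} → G ≅ H → H ≅ G
≅-sym {G} {H} G≅H = record
  { to        = from
  ; from      = to
  ; from∘to   = to∘from
  ; to∘from   = from∘to
  ; preserves = λ u v → trans (sym (preserves (from u) (from v))) (cong₂ (adj H) (to∘from u) (to∘from v))
  }
  where open _≅_ G≅H

preimage : ∀ {k} → (Fin m → Fin k) → Subset k → Subset m
preimage f S = tabulate (λ x → lookup S (f x))

module _ {k} {f : Fin m → Fin k} {S : Subset k} {x : Fin m} where

  ∈preimage⁻ : x ∈ preimage f S → f x ∈ S
  ∈preimage⁻ x∈ = lookup⇒[]= (f x) S (trans (sym (lookup∘tabulate _ x)) ([]=⇒lookup x∈))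

  ∈preimage⁺ : f x ∈ S → x ∈ preimage f S
  ∈preimage⁺ fx∈ = lookup⇒[]= x _ (trans (lookup∘tabulate _ x) ([]=⇒lookup fx∈))

∣p∣≡sum : (p : Subset m) → ∣ p ∣ ≡ sum (λ i → if lookup p i then 1 else 0)
∣p∣≡sum []            = refl
∣p∣≡sum (inside ∷ p)  = cong suc (∣p∣≡sum p)
∣p∣≡sum (outside ∷ p) = ∣p∣≡sum p

module Pullback {G H : Graph} (G≅H : G ≅ H) where
  open _≅_ G≅H

  ∣preimage∣ : ∀ T → ∣ preimage to T ∣ ≡ ∣ T ∣
  ∣preimage∣ T = begin
    ∣ preimage to T ∣                                     ≡⟨ ∣p∣≡sum (preimage to T) ⟩
    sum (λ i → if lookup (preimage to T) i then 1 else 0)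
      ≡⟨ sum-cong-≗ (λ i → cong (if_then 1 else 0) (lookup∘tabulate (λ x → lookup T (to x)) i)) ⟩
    sum (λ i → if lookup T (to i) then 1 else 0)          ≡⟨ sum-permute _ (permutation to from to∘from from∘to) ⟨
    sum (λ i → if lookup T i then 1 else 0)               ≡⟨ ∣p∣≡sum T ⟨
    ∣ T ∣                                                 ∎
    where open ≡-Reasoning

  Independent-preimage : ∀ {T} → Independent H T → Independent G (preimage to T)
  Independent-preimage indT u v u∈ v∈ = trans (sym (preserves u v)) (indT _ _ (∈preimage⁻ u∈) (∈preimage⁻ v∈))

  ⊆-preimage : ∀ {S : Subset (n G)} {T} → preimage from S ⊆ T → S ⊆ preimage to T
  ⊆-preimage {S} S⊆T {x} x∈S = ∈preimage⁺ (S⊆T (∈preimage⁺ (subst (_∈ S) (sym (from∘to x)) x∈S)))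

module Transfer {G H : Graph} (G≅H : G ≅ H) where
  open _≅_ G≅H
  open Pullback G≅H
  open Pullback (≅-sym G≅H) using () renaming
    (∣preimage∣ to ∣preimage-from∣; Independent-preimage to Independent-preimage-from)

  n≡ : n G ≡ n H
  n≡ = ↔⇒≡ (permutation to from to∘from from∘to)

  Connected-transfer : Connected H → Connected G
  Connected-transfer connected u v =
    subst₂ (Reach G) (from∘to u) (from∘to v) (pull (connected (to u) (to v)))
    where
    pull : ∀ {x y} → Reach H x y → Reach G (from x) (from y)
    pull here       = here
    pull (step e r) = step (trans (_≅_.preserves (≅-sym G≅H) _ _) e) (pull r)

  Bipartite-transfer : Bipartite H → Bipartite G
  Bipartite-transfer (c , proper) = (λ x → c (to x)) , λ u v e → proper (to u) (to v) (trans (preserves u v) e)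

  Maximum-transfer : ∀ {S} → MaximumIndependent H S → MaximumIndependent G (preimage to S)
  Maximum-transfer {S} (indS , maxS) =
    Independent-preimage indS ,
    λ T indT → subst₂ _≤_ (∣preimage-from∣ T) (sym (∣preimage∣ S)) (maxS _ (Independent-preimage-from indT))

  IsAlpha-transfer : ∀ {a} → IsAlpha H a → IsAlpha G a
  IsAlpha-transfer ((S , indS , ∣S∣≡a) , bound) =
    (preimage to S , Independent-preimage indS , trans (∣preimage∣ S) ∣S∣≡a) ,
    λ T indT → subst (_≤ _) (∣preimage-from∣ T) (bound _ (Independent-preimage-from indT))

  W₂-transfer : W₂ H → W₂ G
  W₂-transfer w S T indS indT S∩T=∅
    with w (preimage from S) (preimage from T) (Independent-preimage-from indS) (Independent-preimage-from indT)
           (λ x x∈S x∈T → S∩T=∅ (from x) (∈preimage⁻ x∈S) (∈preimage⁻ x∈T))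
  ... | S′ , T′ , maxS′ , maxT′ , S⊆S′ , T⊆T′ , S′∩T′=∅ =
    preimage to S′ , preimage to T′ , Maximum-transfer maxS′ , Maximum-transfer maxT′ ,
    ⊆-preimage S⊆S′ , ⊆-preimage T⊆T′ ,
    λ x x∈S′ x∈T′ → S′∩T′=∅ (to x) (∈preimage⁻ x∈S′) (∈preimage⁻ x∈T′)

-- Deciding properties of a fixed small graph

∀-Subset? : {P : Subset m → Set} → (∀ S → Dec (P S)) → Dec (∀ S → P S)
∀-Subset? P? with anySubset? (λ S → ¬? (P? S))
... | yes (S , ¬PS) = no λ ∀P → ¬PS (∀P S)
... | no  ∄¬P       = yes λ S → decidable-stable (P? S) λ ¬PS → ∄¬P (S , ¬PS)

subsets : ∀ m → List (Subset m)
subsets zero    = [] ∷ []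
subsets (suc m) = map (inside ∷_) (subsets m) ++ map (outside ∷_) (subsets m)

module Decide (H : Graph) where

  Independent? : ∀ S → Dec (Independent H S)
  Independent? S = all? λ u → all? λ v → (u ∈? S) →-dec (v ∈? S) →-dec (adj H u v ≟ᵇ false)

  Disjoint? : ∀ S T → Dec (Disjoint {n H} S T)
  Disjoint? S T = all? λ x → (x ∈? S) →-dec (x ∈? T) →-dec no λ ()

  α≤? : ∀ a → Dec (∀ T → Independent H T → ∣ T ∣ ≤ a)
  α≤? a = ∀-Subset? λ T → Independent? T →-dec ∣ T ∣ ℕ.≤? a

  -- The extensions demanded by W₂ are searched for among pairs of independent a-sets.
  ExtendsTo : ℕ → Subset (n H) → Subset (n H) → Subset (n H) × Subset (n H) → Set
  ExtendsTo a S T (S′ , T′) =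
    S ⊆ S′ × T ⊆ T′ × Disjoint S′ T′ × Independent H S′ × Independent H T′ × ∣ S′ ∣ ≡ a × ∣ T′ ∣ ≡ a

  ExtendsTo? : ∀ a S T ST′ → Dec (ExtendsTo a S T ST′)
  ExtendsTo? a S T (S′ , T′) =
    S ⊆? S′ ×-dec T ⊆? T′ ×-dec Disjoint? S′ T′ ×-dec Independent? S′ ×-dec Independent? T′ ×-dec
    ∣ S′ ∣ ℕ.≟ a ×-dec ∣ T′ ∣ ℕ.≟ a

  candidates : ℕ → List (Subset (n H) × Subset (n H))
  candidates a = cartesianProduct sets sets
    where sets = filter (λ S → Independent? S ×-dec ∣ S ∣ ℕ.≟ a) (subsets (n H))

  W₂-Witnessed : ℕ → Set
  W₂-Witnessed a = ∀ S T → Independent H S → Independent H T → Disjoint S T →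
                   Any (ExtendsTo a S T) (candidates a)

  W₂-Witnessed? : ∀ a → Dec (W₂-Witnessed a)
  W₂-Witnessed? a = ∀-Subset? λ S → ∀-Subset? λ T →
    Independent? S →-dec Independent? T →-dec Disjoint? S T →-dec anyList? (ExtendsTo? a S T) (candidates a)

  W₂-by-search : ∀ a → {True (α≤? a)} → {True (W₂-Witnessed? a)} → W₂ H
  W₂-by-search a {bound} {witnessed} S T indS indT S∩T=∅
    with satisfied (toWitness witnessed S T indS indT S∩T=∅)
  ... | (S′ , T′) , S⊆S′ , T⊆T′ , S′∩T′=∅ , indS′ , indT′ , ∣S′∣≡a , ∣T′∣≡a =
    S′ , T′ , (indS′ , λ X indX → subst (_ ≤_) (sym ∣S′∣≡a) (toWitness bound X indX)) ,
    (indT′ , λ X indX → subst (_ ≤_) (sym ∣T′∣≡a) (toWitness bound X indX)) , S⊆S′ , T⊆T′ , S′∩T′=∅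

  IsAlpha-by-search : ∀ S → {True (Independent? S)} → {True (α≤? ∣ S ∣)} → IsAlpha H ∣ S ∣
  IsAlpha-by-search S {indS} {bound} = (S , toWitness indS , refl) , toWitness bound

-- Consequences of W₂

W₂⇒∃α : ∀ {G} → W₂ G → ∃[ a ] IsAlpha G a
W₂⇒∃α w with w ∅ ∅ Independent-∅ Independent-∅ Disjoint-∅ˡ
... | S′ , _ , (indS′ , maxS′) , _ = ∣ S′ ∣ , (S′ , indS′ , refl) , maxS′

bipartite⇒n≤2α : ∀ {G a} → Bipartite G → (∀ T → Independent G T → ∣ T ∣ ≤ a) → n G ≤ a + a
bipartite⇒n≤2α {G} {a} (c , proper) ≤α = begin
  n G                    ≡⟨ m+[n∸m]≡n (∣p∣≤n X) ⟨
  ∣ X ∣ + (n G ∸ ∣ X ∣)  ≡⟨ cong (∣ X ∣ +_) (∣∁p∣≡n∸∣p∣ X) ⟨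
  ∣ X ∣ + ∣ ∁ X ∣        ≤⟨ +-mono-≤ (≤α X indX) (≤α (∁ X) ind∁X) ⟩
  a + a                  ∎
  where
  open ≤-Reasoning
  X = tabulate c
  monochromatic⇒≁ : ∀ {b u v} → c u ≡ b → c v ≡ b → adj G u v ≡ false
  monochromatic⇒≁ cu≡b cv≡b = ≢true⇒≡false λ u~v →
    not-¬ refl (trans (sym cu≡b) (trans (proper _ _ u~v) (cong not cv≡b)))
  indX : Independent G X
  indX u v u∈X v∈X = monochromatic⇒≁ (∈tabulate⁻ u∈X) (∈tabulate⁻ v∈X)
  ind∁X : Independent G (∁ X)
  ind∁X u v u∈∁X v∈∁X = monochromatic⇒≁ (∉tabulate⁻ (x∈∁p⇒x∉p u∈∁X)) (∉tabulate⁻ (x∈∁p⇒x∉p v∈∁X))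

module W₂-Graph {G : Graph} (sg : IsSimpleGraph G) (w : W₂ G) {a : ℕ} (α : IsAlpha G a) where
  open IsSimpleGraph sg
  open SimpleGraph sg

  private
    variable
      u v : Fin (n G)
      S T D : Subset (n G)

  ≤α : Independent G S → ∣ S ∣ ≤ a
  ≤α = proj₂ α _

  Maximum⇒≡α : MaximumIndependent G S → ∣ S ∣ ≡ a
  Maximum⇒≡α (indS , maxS) with proj₁ α
  ... | A , indA , ∣A∣≡a = ≤-antisym (≤α indS) (subst (_≤ _) ∣A∣≡a (maxS A indA))

  avoiding⇒2α+∣D∣≤n : MaximumIndependent G S → MaximumIndependent G T → Disjoint S T →
                      (∀ d → d ∈ D → d ∉ S × d ∉ T) → a + a + ∣ D ∣ ≤ n G
  avoiding⇒2α+∣D∣≤n {S} {T} {D} maxS maxT S∩T=∅ avoids =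
    subst (λ k → k + ∣ D ∣ ≤ n G)
          (trans (∣p∪q∣≡∣p∣+∣q∣ S T S∩T=∅) (cong₂ _+_ (Maximum⇒≡α maxS) (Maximum⇒≡α maxT)))
          (Disjoint⇒∣p∣+∣q∣≤m (S ∪ T) D
            (Disjoint-∪ˡ (λ d d∈S d∈D → proj₁ (avoids d d∈D) d∈S) (λ d d∈T d∈D → proj₂ (avoids d d∈D) d∈T)))

  -- A vertex with neighbours in S and in T lies outside any independent extensions of S and T.
  biadjacent⇒2α+∣D∣≤n : Independent G S → Independent G T → Disjoint S T →
                        (∀ d → d ∈ D → Biadjacent G S T d) → a + a + ∣ D ∣ ≤ n G
  biadjacent⇒2α+∣D∣≤n indS indT S∩T=∅ biadj with w _ _ indS indT S∩T=∅
  ... | S′ , T′ , maxS′ , maxT′ , S⊆S′ , T⊆T′ , S′∩T′=∅ =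
    avoiding⇒2α+∣D∣≤n maxS′ maxT′ S′∩T′=∅ λ d d∈D →
      let ((s , s∈S , d~s) , (t , t∈T , d~t)) = biadj d d∈D in
      (λ d∈S′ → Independent⇒neighbour∉ (proj₁ maxS′) d∈S′ d~s (S⊆S′ s∈S)) ,
      (λ d∈T′ → Independent⇒neighbour∉ (proj₁ maxT′) d∈T′ d~t (T⊆T′ t∈T))

  2α≤n : a + a ≤ n G
  2α≤n = subst (_≤ n G) (trans (cong (a + a +_) (∣⊥∣≡0 (n G))) (+-identityʳ (a + a)))
           (biadjacent⇒2α+∣D∣≤n Independent-∅ Independent-∅ Disjoint-∅ˡ λ _ d∈∅ → ⊥-elim (∉⊥ d∈∅))

  1≤α : Fin (n G) → 1 ≤ a
  1≤α v = subst (_≤ a) (∣⁅x⁆∣≡1 v) (≤α (Independent-⁅⁆ v))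

  v₀ : Fin (n G)
  v₀ = fromℕ< nonempty

  2≤n : 2 ≤ n G
  2≤n = ≤-trans (+-mono-≤ (1≤α v₀) (1≤α v₀)) 2α≤n

  two-neighbours⇒2α+1≤n : adj G v x ≡ true → adj G v y ≡ true → x ≢ y → a + a + 1 ≤ n G
  two-neighbours⇒2α+1≤n {v} {x} {y} v~x v~y x≢y =
    subst (λ k → a + a + k ≤ n G) (∣⁅x⁆∣≡1 v)
      (biadjacent⇒2α+∣D∣≤n (Independent-⁅⁆ x) (Independent-⁅⁆ y) (≢⇒Disjoint⁅⁆ x≢y) biadj)
    where
    biadj : ∀ d → d ∈ ⁅ v ⁆ → Biadjacent G ⁅ x ⁆ ⁅ y ⁆ d
    biadj d d∈ rewrite x∈⁅y⁆⇒x≡y v d∈ = (x , x∈⁅x⁆ x , v~x) , (y , x∈⁅x⁆ y , v~y)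

  biadjacent-pair⇒2α+2≤n : Independent G S → Independent G T → Disjoint S T →
    x ≢ y → Biadjacent G S T x → Biadjacent G S T y → a + a + 2 ≤ n G
  biadjacent-pair⇒2α+2≤n {S} {T} {x} {y} indS indT S∩T=∅ x≢y x-biadj y-biadj =
    subst (λ k → a + a + k ≤ n G) (∣⁅x⁆∪⁅y⁆∣≡2 x≢y) (biadjacent⇒2α+∣D∣≤n indS indT S∩T=∅ biadj)
    where
    biadj : ∀ d → d ∈ ⁅ x ⁆ ∪ ⁅ y ⁆ → Biadjacent G S T d
    biadj d d∈ with ∈⁅x⁆∪⁅y⁆⇒ d∈
    ... | inj₁ refl = x-biadj
    ... | inj₂ refl = y-biadj

  -- W₂ applied to A - v and {v}, for v in a maximum independent set A, yields an S′ ⊇ A - v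
  -- of size |A|; so S′ contains at most one neighbour of v.
  neighbours-in-exchange : ∀ {A S′} → MaximumIndependent G A → v ∈ A → A - v ⊆ S′ → MaximumIndependent G S′ →
    adj G v x ≡ true → adj G v y ≡ true → x ≢ y → x ∈ S′ → y ∈ S′ → ⊥
  neighbours-in-exchange {v} {x} {y} {A} {S′} maxA v∈A A-v⊆S′ maxS′ v~x v~y x≢y x∈S′ y∈S′ =
    n+2≰n+1 ∣ A - v ∣ (≤-trans ∣A-v∣+2≤α α≤∣A-v∣+1)
    where
    ∉A-v : ∀ {u} → adj G v u ≡ true → u ∉ A - v
    ∉A-v v~u u∈A-v = Independent⇒neighbour∉ (proj₁ maxA) v∈A v~u (p─q⊆p A ⁅ v ⁆ u∈A-v)
    ∣A-v∣+2≤α : ∣ A - v ∣ + 2 ≤ a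
    ∣A-v∣+2≤α = subst (_≤ a)
      (trans (∣p∪q∣≡∣p∣+∣q∣ (A - v) _ (∉⇒Disjoint⁅⁆∪⁅⁆ (∉A-v v~x) (∉A-v v~y)))
             (cong (∣ A - v ∣ +_) (∣⁅x⁆∪⁅y⁆∣≡2 x≢y)))
      (≤-trans (p⊆q⇒∣p∣≤∣q∣ (∪-⊆ A-v⊆S′ (⁅x⁆∪⁅y⁆⊆ x∈S′ y∈S′))) (≤-reflexive (Maximum⇒≡α maxS′)))
    A⊆A-v∪⁅v⁆ : A ⊆ (A - v) ∪ ⁅ v ⁆
    A⊆A-v∪⁅v⁆ {u} u∈A with u ≟ᶠ v
    ... | yes refl = x∈p∪q⁺ (inj₂ (x∈⁅x⁆ v))
    ... | no u≢v   = x∈p∪q⁺ (inj₁ (x∈p∧x≢y⇒x∈p-y u∈A u≢v))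
    α≤∣A-v∣+1 : a ≤ ∣ A - v ∣ + 1
    α≤∣A-v∣+1 = begin
      a                      ≡⟨ Maximum⇒≡α maxA ⟨
      ∣ A ∣                  ≤⟨ p⊆q⇒∣p∣≤∣q∣ A⊆A-v∪⁅v⁆ ⟩
      ∣ (A - v) ∪ ⁅ v ⁆ ∣    ≡⟨ ∣p∪q∣≡∣p∣+∣q∣ (A - v) ⁅ v ⁆ (∉⇒Disjoint⁅⁆ (x∉p-x A)) ⟩
      ∣ A - v ∣ + ∣ ⁅ v ⁆ ∣  ≡⟨ cong (∣ A - v ∣ +_) (∣⁅x⁆∣≡1 v) ⟩
      ∣ A - v ∣ + 1          ∎
      where open ≤-Reasoning

  three-neighbours⇒2α+2≤n : adj G v x ≡ true → adj G v y ≡ true → adj G v z ≡ true →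
                            x ≢ y → x ≢ z → y ≢ z → a + a + 2 ≤ n G
  three-neighbours⇒2α+2≤n {v} {x} {y} {z} v~x v~y v~z x≢y x≢z y≢z
    with w ⁅ v ⁆ ∅ (Independent-⁅⁆ v) Independent-∅ Disjoint-∅ʳ
  ... | A , _ , maxA , _ , ⁅v⁆⊆A , _
    with w (A - v) ⁅ v ⁆ (Independent-⊆ (p─q⊆p A ⁅ v ⁆) (proj₁ maxA)) (Independent-⁅⁆ v)
           (∉⇒Disjoint⁅⁆ (x∉p-x A))
  ... | S′ , T′ , maxS′ , maxT′ , A-v⊆S′ , ⁅v⁆⊆T′ , S′∩T′=∅ = pigeonhole (x ∈? S′) (y ∈? S′) (z ∈? S′)
    where
    two-in : ∀ {x y} → adj G v x ≡ true → adj G v y ≡ true → x ≢ y → x ∈ S′ → y ∈ S′ → a + a + 2 ≤ n G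
    two-in v~x v~y x≢y x∈S′ y∈S′ =
      ⊥-elim (neighbours-in-exchange maxA (⁅v⁆⊆A (x∈⁅x⁆ v)) A-v⊆S′ maxS′ v~x v~y x≢y x∈S′ y∈S′)
    two-out : ∀ {x y} → adj G v x ≡ true → adj G v y ≡ true → x ≢ y → x ∉ S′ → y ∉ S′ → a + a + 2 ≤ n G
    two-out {x} {y} v~x v~y x≢y x∉S′ y∉S′ =
      subst (λ k → a + a + k ≤ n G) (∣⁅x⁆∪⁅y⁆∣≡2 x≢y) (avoiding⇒2α+∣D∣≤n maxS′ maxT′ S′∩T′=∅ avoids)
      where
      ∉T′ : ∀ {u} → adj G v u ≡ true → u ∉ T′
      ∉T′ = Independent⇒neighbour∉ (proj₁ maxT′) (⁅v⁆⊆T′ (x∈⁅x⁆ v))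
      avoids : ∀ d → d ∈ ⁅ x ⁆ ∪ ⁅ y ⁆ → d ∉ S′ × d ∉ T′
      avoids d d∈ with ∈⁅x⁆∪⁅y⁆⇒ d∈
      ... | inj₁ refl = x∉S′ , ∉T′ v~x
      ... | inj₂ refl = y∉S′ , ∉T′ v~y
    pigeonhole : Dec (x ∈ S′) → Dec (y ∈ S′) → Dec (z ∈ S′) → a + a + 2 ≤ n G
    pigeonhole (yes x∈) (yes y∈) _        = two-in v~x v~y x≢y x∈ y∈
    pigeonhole (yes x∈) (no _)   (yes z∈) = two-in v~x v~z x≢z x∈ z∈
    pigeonhole (no _)   (yes y∈) (yes z∈) = two-in v~y v~z y≢z y∈ z∈
    pigeonhole (yes _)  (no y∉)  (no z∉)  = two-out v~y v~z y≢z y∉ z∉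
    pigeonhole (no x∉)  (yes _)  (no z∉)  = two-out v~x v~z x≢z x∉ z∉
    pigeonhole (no x∉)  (no y∉)  _        = two-out v~x v~y x≢y x∉ y∉

  -- W₂ applied to {z} and {x}: x's only neighbour y is adjacent to z, so x extends S′ ∋ z.
  leaf-neighbour⇒leaf : (∀ c → adj G x c ≡ true → c ≡ y) → adj G y z ≡ true → z ≡ x
  leaf-neighbour⇒leaf {x} {y} {z} N[x]⊆⁅y⁆ y~z with z ≟ᶠ x
  ... | yes z≡x = z≡x
  ... | no z≢x with w ⁅ z ⁆ ⁅ x ⁆ (Independent-⁅⁆ z) (Independent-⁅⁆ x) (≢⇒Disjoint⁅⁆ z≢x)
  ... | S′ , _ , maxS′ , _ , ⁅z⁆⊆S′ , ⁅x⁆⊆T′ , S′∩T′=∅ =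
    ⊥-elim (m+1+n≰m a (subst (_≤ a) ∣S′∪⁅x⁆∣≡α+1 (≤α (Independent-∪⁅⁆ (proj₁ maxS′) x≁S′))))
    where
    y∉S′ : y ∉ S′
    y∉S′ = Independent⇒neighbour∉ (proj₁ maxS′) (⁅z⁆⊆S′ (x∈⁅x⁆ z)) (adj-sym y~z)
    x∉S′ : x ∉ S′
    x∉S′ x∈S′ = S′∩T′=∅ x x∈S′ (⁅x⁆⊆T′ (x∈⁅x⁆ x))
    x≁S′ : ∀ s → s ∈ S′ → adj G x s ≡ false
    x≁S′ s s∈S′ = ≢true⇒≡false λ x~s → y∉S′ (subst (_∈ S′) (N[x]⊆⁅y⁆ s x~s) s∈S′)
    ∣S′∪⁅x⁆∣≡α+1 : ∣ S′ ∪ ⁅ x ⁆ ∣ ≡ a + 1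
    ∣S′∪⁅x⁆∣≡α+1 =
      trans (∣p∪q∣≡∣p∣+∣q∣ S′ ⁅ x ⁆ (∉⇒Disjoint⁅⁆ x∉S′)) (cong₂ _+_ (Maximum⇒≡α maxS′) (∣⁅x⁆∣≡1 x))

  module _ (connected : Connected G) where

    leaf⇒≅K₂ : adj G x y ≡ true → (∀ c → adj G x c ≡ true → c ≡ y) → G ≅ K₂
    leaf⇒≅K₂ {x} {y} x~y N[x]⊆⁅y⁆ =
      injective-local-iso⇒≅ connected vs ((adj⇒≢ x~y ∷ []) ∷ [] ∷ []) zero edges onto
      where
      vs = x ∷ y ∷ []
      edges : ∀ i j → adj K₂ i j ≡ true → adj G (lookup vs i) (lookup vs j) ≡ true
      edges zero       (suc zero) _ = x~y
      edges (suc zero) zero       _ = adj-sym x~y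
      edges zero       zero       ()
      edges (suc zero) (suc zero) ()
      onto : ∀ i c → adj G (lookup vs i) c ≡ true → ∃[ j ] (adj K₂ i j ≡ true × lookup vs j ≡ c)
      onto zero       c x~c = suc zero , refl , sym (N[x]⊆⁅y⁆ c x~c)
      onto (suc zero) c y~c = zero , refl , sym (leaf-neighbour⇒leaf N[x]⊆⁅y⁆ y~c)

    n≤2α⇒≅K₂ : n G ≤ a + a → G ≅ K₂
    n≤2α⇒≅K₂ n≤2α with has-neighbour connected 2≤n v₀
    ... | u , v₀~u = leaf⇒≅K₂ v₀~u unique-neighbour
      where
      unique-neighbour : ∀ c → adj G v₀ c ≡ true → c ≡ u
      unique-neighbour c v₀~c with c ≟ᶠ u
      ... | yes c≡u = c≡u
      ... | no  c≢u = ⊥-elim (m+1+n≰m (a + a) (≤-trans (two-neighbours⇒2α+1≤n v₀~c v₀~u c≢u) n≤2α))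

-- Connected graphs of maximum degree two

module MaxDegree₂ {G : Graph} (sg : IsSimpleGraph G) (connected : Connected G)
  (≤2-neighbours : ∀ {v x y} → adj G v x ≡ true → adj G v y ≡ true → x ≢ y →
                   ∀ c → adj G v c ≡ true → c ≡ x ⊎ c ≡ y) where
  open SimpleGraph sg

  cycle⇒≅C : ∀ {m} (vs : Vec (Fin (n G)) (suc m)) → Unique vs →
    (∀ i → adj G (lookup vs i) (lookup vs (cycleSucc i)) ≡ true) →
    (∀ i → ∃[ k ] (cycleSucc k ≡ i × k ≢ cycleSucc i)) →
    G ≅ C (suc m)
  cycle⇒≅C {m} vs unique forward predecessor = injective-local-iso⇒≅ connected vs unique zero edges onto
    where
    edges : ∀ i j → adj (C (suc m)) i j ≡ true → adj G (lookup vs i) (lookup vs j) ≡ true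
    edges i j e with adj-C⇒ i j e
    ... | inj₁ refl = forward i
    ... | inj₂ refl = adj-sym (forward j)
    onto : ∀ i c → adj G (lookup vs i) c ≡ true → ∃[ j ] (adj (C (suc m)) i j ≡ true × lookup vs j ≡ c)
    onto i c vsᵢ~c with predecessor i
    ... | k , refl , k≢i⁺ with ≤2-neighbours (forward i) (adj-sym (forward k))
                                   (k≢i⁺ ∘ sym ∘ lookup-injective unique _ _) c vsᵢ~c
    ...   | inj₁ refl = cycleSucc i , adj-C-cycleSucc i , refl
    ...   | inj₂ refl = k , trans (C-symmetric _ k) (adj-C-cycleSucc k) , refl

  triangle⇒≅C₃ : ∀ {u v w} → adj G u v ≡ true → adj G v w ≡ true → adj G w u ≡ true → G ≅ C 3
  triangle⇒≅C₃ {u} {v} {w} u~v v~w w~u = cycle⇒≅C vs unique forward predecessor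
    where
    vs = u ∷ v ∷ w ∷ []
    unique : Unique vs
    unique = (adj⇒≢ u~v ∷ ≢-sym (adj⇒≢ w~u) ∷ []) ∷ (adj⇒≢ v~w ∷ []) ∷ [] ∷ []
    forward : ∀ i → adj G (lookup vs i) (lookup vs (cycleSucc i)) ≡ true
    forward 0F = u~v
    forward 1F = v~w
    forward 2F = w~u
    predecessor : ∀ i → ∃[ k ] (cycleSucc k ≡ i × k ≢ cycleSucc i)
    predecessor 0F = 2F , refl , λ ()
    predecessor 1F = 0F , refl , λ ()
    predecessor 2F = 1F , refl , λ ()

  pentagon⇒≅C₅ : ∀ {v₀ v₁ v₂ v₃ v₄} → Unique (v₀ ∷ v₁ ∷ v₂ ∷ v₃ ∷ v₄ ∷ []) →
    adj G v₀ v₁ ≡ true → adj G v₁ v₂ ≡ true → adj G v₂ v₃ ≡ true → adj G v₃ v₄ ≡ true → adj G v₄ v₀ ≡ true →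
    G ≅ C 5
  pentagon⇒≅C₅ {v₀} {v₁} {v₂} {v₃} {v₄} unique v₀~v₁ v₁~v₂ v₂~v₃ v₃~v₄ v₄~v₀ =
    cycle⇒≅C vs unique forward predecessor
    where
    vs = v₀ ∷ v₁ ∷ v₂ ∷ v₃ ∷ v₄ ∷ []
    forward : ∀ i → adj G (lookup vs i) (lookup vs (cycleSucc i)) ≡ true
    forward 0F = v₀~v₁
    forward 1F = v₁~v₂
    forward 2F = v₂~v₃
    forward 3F = v₃~v₄
    forward 4F = v₄~v₀
    predecessor : ∀ i → ∃[ k ] (cycleSucc k ≡ i × k ≢ cycleSucc i)
    predecessor 0F = 4F , refl , λ ()
    predecessor 1F = 0F , refl , λ ()
    predecessor 2F = 1F , refl , λ ()
    predecessor 3F = 2F , refl , λ ()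
    predecessor 4F = 3F , refl , λ ()

-- W₂ graphs of odd order 2α + 1

module OddOrder {G : Graph} (sg : IsSimpleGraph G) (w : W₂ G) {a : ℕ} (α : IsAlpha G a)
                (n≡2α+1 : n G ≡ 2 * a + 1) (connected : Connected G) where
  open SimpleGraph sg
  open W₂-Graph sg w α

  2α+2≰n : ¬ (a + a + 2 ≤ n G)
  2α+2≰n 2α+2≤n = n+2≰n+1 (a + a) (subst (a + a + 2 ≤_) (trans n≡2α+1 (cong (_+ 1) (2*m≡m+m a))) 2α+2≤n)

  ≤2-neighbours : ∀ {v x y} → adj G v x ≡ true → adj G v y ≡ true → x ≢ y →
                  ∀ c → adj G v c ≡ true → c ≡ x ⊎ c ≡ y
  ≤2-neighbours {x = x} {y} v~x v~y x≢y c v~c with c ≟ᶠ x | c ≟ᶠ y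
  ... | yes c≡x | _       = inj₁ c≡x
  ... | no _    | yes c≡y = inj₂ c≡y
  ... | no c≢x  | no c≢y  =
    ⊥-elim (2α+2≰n (three-neighbours⇒2α+2≤n v~x v~y v~c x≢y (≢-sym c≢x) (≢-sym c≢y)))

  open MaxDegree₂ sg connected ≤2-neighbours

  no-leaf : ∀ {x y} → adj G x y ≡ true → ¬ (∀ c → adj G x c ≡ true → c ≡ y)
  no-leaf x~y N[x]⊆⁅y⁆ =
    even≢odd 1 a (trans (sym (Transfer.n≡ (leaf⇒≅K₂ connected x~y N[x]⊆⁅y⁆)))
                        (trans n≡2α+1 (+-comm (2 * a) 1)))

  other-neighbour : ∀ {u v} → adj G u v ≡ true →
                    ∃[ w ] (w ≢ u × adj G v w ≡ true × ∀ c → adj G v c ≡ true → c ≡ u ⊎ c ≡ w)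
  other-neighbour {u} {v} u~v with any? (λ w → (adj G v w ≟ᵇ true) ×-dec ¬? (w ≟ᶠ u))
  ... | yes (w , v~w , w≢u) = w , w≢u , v~w , ≤2-neighbours (adj-sym u~v) v~w (≢-sym w≢u)
  ... | no ∄ = ⊥-elim (no-leaf (adj-sym u~v) λ c v~c → decidable-stable (c ≟ᶠ u) λ c≢u → ∄ (c , v~c , c≢u))

  -- The paths p′ - p - v - q - q′ close up into a pentagon; otherwise p′ has a further neighbour p″
  -- and p, q are biadjacent to the independent sets {p″, v} and {p′, q′}.
  pentagon-or-P₆ : ∀ {v p q p′} → adj G v p ≡ true → adj G v q ≡ true → adj G p p′ ≡ true →
    p′ ≢ v → p′ ≢ q → q ≢ p →
    (∀ c → adj G v c ≡ true → c ≡ p ⊎ c ≡ q) → (∀ c → adj G p c ≡ true → c ≡ v ⊎ c ≡ p′) →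
    G ≅ C 5
  pentagon-or-P₆ {v} {p} {q} {p′} v~p v~q p~p′ p′≢v p′≢q q≢p N[v] N[p] with other-neighbour v~q
  ... | q′ , q′≢v , q~q′ , N[q] = close (adj G p′ q′) refl
    where
    q′≢p : q′ ≢ p
    q′≢p refl with N[p] q (adj-sym q~q′)
    ... | inj₁ q≡v  = adj⇒≢ v~q (sym q≡v)
    ... | inj₂ q≡p′ = p′≢q (sym q≡p′)
    close : ∀ b → adj G p′ q′ ≡ b → G ≅ C 5
    close true p′~q′ = pentagon⇒≅C₅ unique v~p p~p′ p′~q′ (adj-sym q~q′) (adj-sym v~q)
      where
      unique : Unique (v ∷ p ∷ p′ ∷ q′ ∷ q ∷ [])
      unique = (adj⇒≢ v~p ∷ ≢-sym p′≢v ∷ ≢-sym q′≢v ∷ adj⇒≢ v~q ∷ [])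
             ∷ (adj⇒≢ p~p′ ∷ ≢-sym q′≢p ∷ ≢-sym q≢p ∷ [])
             ∷ (adj⇒≢ p′~q′ ∷ p′≢q ∷ [])
             ∷ (≢-sym (adj⇒≢ q~q′) ∷ [])
             ∷ [] ∷ []
    close false p′≁q′ with other-neighbour p~p′
    ... | p″ , p″≢p , p′~p″ , _ = ⊥-elim (2α+2≰n
      (biadjacent-pair⇒2α+2≤n (Independent-⁅⁆∪⁅⁆ p″≁v) (Independent-⁅⁆∪⁅⁆ p′≁q′)
        (≢⇒Disjoint⁅⁆∪⁅⁆ (≢-sym (adj⇒≢ p′~p″)) p″≢q′ (≢-sym p′≢v) (≢-sym q′≢v)) (≢-sym q≢p)
        ((v , y∈⁅x⁆∪⁅y⁆ , adj-sym v~p) , (p′ , x∈⁅x⁆∪⁅y⁆ , p~p′))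
        ((v , y∈⁅x⁆∪⁅y⁆ , adj-sym v~q) , (q′ , y∈⁅x⁆∪⁅y⁆ , q~q′))))
      where
      no-C₄ : p′ ≢ q′
      no-C₄ refl = 2α+2≰n (biadjacent-pair⇒2α+2≤n (Independent-⁅⁆ v) (Independent-⁅⁆ p′)
        (≢⇒Disjoint⁅⁆ (≢-sym p′≢v)) (≢-sym q≢p)
        ((v , x∈⁅x⁆ v , adj-sym v~p) , (p′ , x∈⁅x⁆ p′ , p~p′))
        ((v , x∈⁅x⁆ v , adj-sym v~q) , (p′ , x∈⁅x⁆ p′ , q~q′)))
      p″≢q′ : p″ ≢ q′
      p″≢q′ refl = true≢false (trans (sym p′~p″) p′≁q′)
      p″≁v : adj G p″ v ≡ false
      p″≁v = ≢true⇒≡false λ p″~v → excluded (N[v] p″ (adj-sym p″~v))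
        where
        excluded : p″ ≡ p ⊎ p″ ≡ q → ⊥
        excluded (inj₁ p″≡p) = p″≢p p″≡p
        excluded (inj₂ refl) with N[q] p′ (adj-sym p′~p″)
        ... | inj₁ p′≡v  = p′≢v p′≡v
        ... | inj₂ p′≡q′ = no-C₄ p′≡q′

  ≅C₃⊎≅C₅ : (G ≅ C 3) ⊎ (G ≅ C 5)
  ≅C₃⊎≅C₅ with has-neighbour connected 2≤n v₀
  ... | p , v₀~p with other-neighbour (adj-sym v₀~p) | other-neighbour v₀~p
  ... | q , q≢p , v₀~q , N[v₀] | p′ , p′≢v₀ , p~p′ , N[p] with p′ ≟ᶠ q
  ...   | yes refl = inj₁ (triangle⇒≅C₃ v₀~p p~p′ (adj-sym v₀~q))
  ...   | no p′≢q  = inj₂ (pentagon-or-P₆ v₀~p v₀~q p~p′ p′≢v₀ p′≢q q≢p N[v₀] N[p])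

K₂-symmetric : ∀ u v → adj K₂ u v ≡ adj K₂ v u
K₂-symmetric 0F 0F = refl
K₂-symmetric 0F 1F = refl
K₂-symmetric 1F 0F = refl
K₂-symmetric 1F 1F = refl

K₂-connected : Connected K₂
K₂-connected = reachable-from⇒Connected K₂-symmetric 0F λ where
  0F → here
  1F → step refl here

C₃-connected : Connected (C 3)
C₃-connected = reachable-from⇒Connected C-symmetric 0F λ where
  0F → here
  1F → step refl here
  2F → step refl here

C₅-connected : Connected (C 5)
C₅-connected = reachable-from⇒Connected C-symmetric 0F λ where
  0F → here
  1F → step refl here
  2F → step {w = 1F} refl (step refl here)
  3F → step {w = 4F} refl (step refl here)
  4F → step refl here

K₂-bipartite : Bipartite K₂
K₂-bipartite = colour , proper
  where
  colour : Fin 2 → Bool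
  colour 0F = true
  colour 1F = false
  proper : ∀ u v → adj K₂ u v ≡ true → colour u ≡ not (colour v)
  proper 0F 1F _ = refl
  proper 1F 0F _ = refl
  proper 0F 0F ()
  proper 1F 1F ()

K₂-W₂ : W₂ K₂
K₂-W₂ = Decide.W₂-by-search K₂ 1

C₃-W₂ : W₂ (C 3)
C₃-W₂ = Decide.W₂-by-search (C 3) 1

C₅-W₂ : W₂ (C 5)
C₅-W₂ = Decide.W₂-by-search (C 5) 2

K₂-α : IsAlpha K₂ 1
K₂-α = Decide.IsAlpha-by-search K₂ ⁅ 0F ⁆

C₃-α : IsAlpha (C 3) 1
C₃-α = Decide.IsAlpha-by-search (C 3) ⁅ 0F ⁆

C₅-α : IsAlpha (C 5) 2
C₅-α = Decide.IsAlpha-by-search (C 5) (⁅ 0F ⁆ ∪ ⁅ 2F ⁆)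

corollary2p8 :
    (∀ G → IsSimpleGraph G →
       ((Connected G × W₂ G × ∃[ a ] (IsAlpha G a × n G ≡ 2 * a)) ⇔ (G ≅ K₂)))
    × (∀ G → IsSimpleGraph G →
       ((Connected G × W₂ G × ∃[ a ] (IsAlpha G a × n G ≡ 2 * a + 1))
          ⇔ ((G ≅ C 3) ⊎ (G ≅ C 5))))
    × (∀ G → IsSimpleGraph G →
       ((Connected G × Bipartite G × W₂ G) ⇔ (G ≅ K₂)))
corollary2p8 = order-2α , order-2α+1 , bipartite
  where
  order-2α : ∀ G → IsSimpleGraph G → (Connected G × W₂ G × ∃[ a ] (IsAlpha G a × n G ≡ 2 * a)) ⇔ (G ≅ K₂)
  order-2α G sg = mk⇔
    (λ { (connected , w , a , α , n≡2α) →
         W₂-Graph.n≤2α⇒≅K₂ sg w α connected (≤-reflexive (trans n≡2α (2*m≡m+m a))) })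
    (λ G≅K₂ → let open Transfer G≅K₂ in
      Connected-transfer K₂-connected , W₂-transfer K₂-W₂ , 1 , IsAlpha-transfer K₂-α , n≡)

  order-2α+1 : ∀ G → IsSimpleGraph G →
    (Connected G × W₂ G × ∃[ a ] (IsAlpha G a × n G ≡ 2 * a + 1)) ⇔ ((G ≅ C 3) ⊎ (G ≅ C 5))
  order-2α+1 G sg = mk⇔
    (λ { (connected , w , a , α , n≡2α+1) → OddOrder.≅C₃⊎≅C₅ sg w α n≡2α+1 connected })
    λ { (inj₁ G≅C₃) → let open Transfer G≅C₃ in
          Connected-transfer C₃-connected , W₂-transfer C₃-W₂ , 1 , IsAlpha-transfer C₃-α , n≡
      ; (inj₂ G≅C₅) → let open Transfer G≅C₅ in
          Connected-transfer C₅-connected , W₂-transfer C₅-W₂ , 2 , IsAlpha-transfer C₅-α , n≡ }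

  bipartite : ∀ G → IsSimpleGraph G → (Connected G × Bipartite G × W₂ G) ⇔ (G ≅ K₂)
  bipartite G sg = mk⇔
    (λ { (connected , bip , w) → let (a , α) = W₂⇒∃α w in
         W₂-Graph.n≤2α⇒≅K₂ sg w α connected (bipartite⇒n≤2α bip (proj₂ α)) })
    (λ G≅K₂ → let open Transfer G≅K₂ in
      Connected-transfer K₂-connected , Bipartite-transfer K₂-bipartite , W₂-transfer K₂-W₂)
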